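{- Let $A \in SL_2(\mathbb{Z})$ be hyperbolic, i.e. $|\operatorname{tr}(A)|>2$. Then for $y \geq 1$, the number of primes $p$ such that $\operatorname{ord}_p(A) \leq y$ is $O(y^2)$, where the implied constant depends only on $A$.
   Context: For a prime $p$, $\operatorname{ord}_p(A)$ denotes the order of the reduction of $A$ modulo $p$ in $SL_2(\mathbb{F}_p)$. -}

module Defs where

open import Data.Nat as ℕ using (ℕ; zero; suc)
open import Data.Integer as ℤ using (ℤ; +_; _-_)
open import Data.Integer.Divisibility using (_∣_)
open import Data.Product using (Σ; _×_)
open import Relation.Nullary using (¬_)

record Mat2 : Set where
  constructor mat
  field
    a b c d : ℤ
open Mat2 public

_⊗_ : Mat2 → Mat2 → Mat2
mat a₁ b₁ c₁ d₁ ⊗ mat a₂ b₂ c₂ d₂ =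
  mat (a₁ ℤ.* a₂ ℤ.+ b₁ ℤ.* c₂) (a₁ ℤ.* b₂ ℤ.+ b₁ ℤ.* d₂)
      (c₁ ℤ.* a₂ ℤ.+ d₁ ℤ.* c₂) (c₁ ℤ.* b₂ ℤ.+ d₁ ℤ.* d₂)

I₂ : Mat2
I₂ = mat (+ 1) (+ 0) (+ 0) (+ 1)

_^ᴹ_ : Mat2 → ℕ → Mat2
A ^ᴹ zero  = I₂
A ^ᴹ suc n = A ⊗ (A ^ᴹ n)

det : Mat2 → ℤ
det (mat a b c d) = a ℤ.* d - b ℤ.* c

tr : Mat2 → ℤ
tr (mat a b c d) = a ℤ.+ d

≡I-mod : ℕ → Mat2 → Set
≡I-mod p (mat a b c d) =
  ((+ p) ∣ (a - + 1)) × ((+ p) ∣ b) × ((+ p) ∣ c) × ((+ p) ∣ (d - + 1))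

IsOrder : ℕ → Mat2 → ℕ → Set
IsOrder p A n =
  (1 ℕ.≤ n) × ≡I-mod p (A ^ᴹ n) ×
  ((m : ℕ) → 1 ℕ.≤ m → m ℕ.< n → ¬ ≡I-mod p (A ^ᴹ m))

OrdLe : ℕ → Mat2 → ℕ → Set
OrdLe p A y = Σ ℕ (λ n → IsOrder p A n × n ℕ.≤ y)

{-# OPTIONS --safe #-}
-- Write T_n = tr(A^n). If A^n ≡ I (mod p) then p ∣ T_n - 2, so every prime p
-- with ord_p(A) ≤ y divides the product of the |T_n - 2| for 1 ≤ n ≤ y. By
-- Cayley–Hamilton T_{n+2} = tr(A) T_{n+1} - T_n; as |tr A| ≥ 3 this makes |T_n|
-- nondecreasing, so no factor vanishes, and at most (1 + |tr A|)^(n+1), so the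
-- product is at most B^(y²) with B = (1 + |tr A|)^3. A positive integer with k
-- distinct prime factors is at least 2^k, hence k ≤ log₂ B^(y²) ≤ B y².
module Submission where

open import Defs
open import Data.Nat using (ℕ; _≤_; _<_; _*_)
open import Data.Integer using (ℤ; +_; ∣_∣)
open import Data.Nat.Primality using (Prime)
open import Data.List using (List; length)
open import Data.List.Relation.Unary.All using (All)
open import Data.List.Relation.Unary.Unique.Propositional using (Unique)
open import Data.Product using (Σ; _×_)
open import Relation.Binary.PropositionalEquality using (_≡_)

open import Function using (_∘_)
open import Data.Nat
  using (zero; suc; _+_; _^_; z≤n; s≤s; _≤′_; ≤′-refl; ≤′-step; NonZero; >-nonZero; >-nonZero⁻¹; nonTrivial⇒n>1)
open import Data.Nat.Properties
open import Data.Nat.Divisibility using (_∣_; divides; ∣-trans)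
open import Data.Nat.Primality using (euclidsLemma; prime⇒irreducible; prime⇒nonTrivial; ¬prime[1])
open import Data.Nat.ListAction using (product)
open import Data.Nat.ListAction.Properties using (∈⇒∣product; product≢0)
import Data.Integer as ℤ
import Data.Integer.Properties as ℤ
import Data.Integer.Divisibility as ℤ
import Data.Integer.Divisibility.Signed as ℤˢ
open import Data.Integer.Tactic.RingSolver using (solve-∀)
open import Data.List using ([]; _∷_; applyUpTo)
open import Data.List.Properties using (length-applyUpTo)
open import Data.List.Membership.Propositional.Properties using (∈-applyUpTo⁺)
open import Data.List.Relation.Unary.All using ([]; _∷_; zipWith)
import Data.List.Relation.Unary.All as All
open import Data.List.Relation.Unary.All.Properties using (applyUpTo⁺₁; applyUpTo⁺₂)
open import Data.List.Relation.Unary.AllPairs using ([]; _∷_)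
open import Data.Product using (_,_; map₂)
open import Data.Sum using (inj₁; inj₂)
open import Relation.Nullary using (contradiction)
open import Relation.Binary.PropositionalEquality using (_≢_; refl; sym; cong; subst; ≢-sym; module ≡-Reasoning)

n<2^n : ∀ n → n < 2 ^ n
n<2^n zero    = s≤s z≤n
n<2^n (suc n) = begin-strict
  suc n              <⟨ +-mono-≤ (m^n>0 2 n) (n<2^n n) ⟩
  2 ^ n + 2 ^ n      ≡⟨ cong (_+_ (2 ^ n)) (+-identityʳ (2 ^ n)) ⟨
  2 ^ suc n          ∎
  where open ≤-Reasoning

^-cancelˡ-≤ : ∀ m {i j} → 1 < m → m ^ i ≤ m ^ j → i ≤ j
^-cancelˡ-≤ m 1<m mⁱ≤mʲ = ≮⇒≥ (λ j<i → <⇒≱ (^-monoʳ-< m 1<m j<i) mⁱ≤mʲ)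

product≤^length : ∀ {m ns} → All (_≤ m) ns → product ns ≤ m ^ length ns
product≤^length []            = ≤-refl
product≤^length (n≤m ∷ ns≤m) = *-mono-≤ n≤m (product≤^length ns≤m)

nondecreasing⇒monotone : (u : ℕ → ℕ) → (∀ n → u n ≤ u (suc n)) → ∀ {m n} → m ≤ n → u m ≤ u n
nondecreasing⇒monotone u step m≤n = go (≤⇒≤′ m≤n)
  where
  go : ∀ {m n} → m ≤′ n → u m ≤ u n
  go ≤′-refl        = ≤-refl
  go (≤′-step m≤′n) = ≤-trans (go m≤′n) (step _)

convex⇒nondecreasing : (u : ℕ → ℕ) → (∀ n → 2 * u (suc n) ≤ u (2 + n) + u n) →
  u 0 ≤ u 1 → ∀ n → u n ≤ u (suc n)
convex⇒nondecreasing u convex u₀≤u₁ zero    = u₀≤u₁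
convex⇒nondecreasing u convex u₀≤u₁ (suc n) = +-cancelʳ-≤ v v (u (2 + n)) (begin
  v + v              ≡⟨ cong (_+_ v) (+-identityʳ v) ⟨
  2 * v              ≤⟨ convex n ⟩
  u (2 + n) + u n    ≤⟨ +-monoʳ-≤ (u (2 + n)) (convex⇒nondecreasing u convex u₀≤u₁ n) ⟩
  u (2 + n) + v      ∎)
  where
  open ≤-Reasoning
  v : ℕ
  v = u (suc n)

exponential-bound : (u : ℕ → ℕ) (s : ℕ) → (∀ n → u (2 + n) ≤ s * u (suc n) + u n) →
  u 0 ≤ suc s → u 1 ≤ suc s ^ 2 → ∀ n → u n ≤ suc s ^ suc n
exponential-bound u s recurrence u₀≤1+s u₁≤[1+s]² = bound
  where
  open ≤-Reasoning
  bound : ∀ n → u n ≤ suc s ^ suc n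
  bound zero          = subst (u 0 ≤_) (sym (*-identityʳ (suc s))) u₀≤1+s
  bound (suc zero)    = u₁≤[1+s]²
  bound (suc (suc n)) = begin
    u (2 + n)                      ≤⟨ recurrence n ⟩
    s * u (suc n) + u n            ≤⟨ +-mono-≤ (*-monoʳ-≤ s (bound (suc n))) (bound n) ⟩
    s * (suc s * r) + r            ≤⟨ +-monoʳ-≤ (s * (suc s * r)) (m≤n*m r (suc s)) ⟩
    s * (suc s * r) + suc s * r    ≡⟨ +-comm (s * (suc s * r)) (suc s * r) ⟩
    suc s * (suc s * r)            ∎
    where
    r : ℕ
    r = suc s ^ suc n

∣i∣≤∣i-j∣+∣j∣ : ∀ i j → ∣ i ∣ ≤ ∣ i ℤ.- j ∣ + ∣ j ∣
∣i∣≤∣i-j∣+∣j∣ i j = subst (λ k → ∣ k ∣ ≤ ∣ i ℤ.- j ∣ + ∣ j ∣) (i-j+j≡i i j) (ℤ.∣i+j∣≤∣i∣+∣j∣ (i ℤ.- j) j)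
  where
  i-j+j≡i : ∀ i j → (i ℤ.- j) ℤ.+ j ≡ i
  i-j+j≡i = solve-∀

prime∣prime⇒≡ : ∀ {p q} → Prime p → Prime q → p ∣ q → p ≡ q
prime∣prime⇒≡ pp pq p∣q with prime⇒irreducible pq p∣q
... | inj₁ refl = contradiction pp ¬prime[1]
... | inj₂ p≡q  = p≡q

distinct-primes∣⇒2^length≤ : ∀ {m ps} .{{_ : NonZero m}} → Unique ps →
  All (λ p → Prime p × p ∣ m) ps → 2 ^ length ps ≤ m
distinct-primes∣⇒2^length≤ {m} [] [] = >-nonZero⁻¹ m
distinct-primes∣⇒2^length≤ {ps = p ∷ ps} (p∉ps ∷ unique) ((pp , divides k refl) ∷ rest) = begin
  2 * 2 ^ length ps  ≤⟨ *-mono-≤ (nonTrivial⇒n>1 p {{prime⇒nonTrivial pp}}) 2^|ps|≤k ⟩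
  p * k              ≡⟨ *-comm p k ⟩
  k * p              ∎
  where
  open ≤-Reasoning
  instance
    k≢0 : NonZero k
    k≢0 = m*n≢0⇒m≢0 k
  ∣k*p⇒∣k : ∀ {q} → p ≢ q × (Prime q × q ∣ k * p) → Prime q × q ∣ k
  ∣k*p⇒∣k (p≢q , pq , q∣kp) with euclidsLemma k p pq q∣kp
  ... | inj₁ q∣k = pq , q∣k
  ... | inj₂ q∣p = contradiction (prime∣prime⇒≡ pq pp q∣p) (≢-sym p≢q)
  2^|ps|≤k : 2 ^ length ps ≤ k
  2^|ps|≤k = distinct-primes∣⇒2^length≤ unique (zipWith ∣k*p⇒∣k (p∉ps , rest))

tr-⊗-I₂ : ∀ A → tr (A ⊗ I₂) ≡ tr A
tr-⊗-I₂ (mat a b c d) = right-unit a b c d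
  where
  right-unit : ∀ a b c d → (a ℤ.* + 1 ℤ.+ b ℤ.* + 0) ℤ.+ (c ℤ.* + 0 ℤ.+ d ℤ.* + 1) ≡ a ℤ.+ d
  right-unit = solve-∀

-- Cayley–Hamilton A² = tr(A) A - det(A) I, multiplied by X and traced.
tr-cayley-hamilton : ∀ A X → tr (A ⊗ (A ⊗ X)) ≡ tr A ℤ.* tr (A ⊗ X) ℤ.- det A ℤ.* tr X
tr-cayley-hamilton (mat a b c d) (mat x y z w) = expanded a b c d x y z w
  where
  expanded : ∀ a b c d x y z w →
    (a ℤ.* (a ℤ.* x ℤ.+ b ℤ.* z) ℤ.+ b ℤ.* (c ℤ.* x ℤ.+ d ℤ.* z)) ℤ.+
      (c ℤ.* (a ℤ.* y ℤ.+ b ℤ.* w) ℤ.+ d ℤ.* (c ℤ.* y ℤ.+ d ℤ.* w))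
    ≡ (a ℤ.+ d) ℤ.* ((a ℤ.* x ℤ.+ b ℤ.* z) ℤ.+ (c ℤ.* y ℤ.+ d ℤ.* w))
      ℤ.- (a ℤ.* d ℤ.- b ℤ.* c) ℤ.* (x ℤ.+ w)
  expanded = solve-∀

∣i∣j⇒∣i+j : ∀ {k i j} → k ℤ.∣ i → k ℤ.∣ j → k ℤ.∣ (i ℤ.+ j)
∣i∣j⇒∣i+j {k} {i} {j} k∣i k∣j =
  ℤˢ.∣⇒∣ᵤ {k} {i ℤ.+ j} (ℤˢ.∣m∣n⇒∣m+n {k} {i} {j} (ℤˢ.∣ᵤ⇒∣ {k} {i} k∣i) (ℤˢ.∣ᵤ⇒∣ {k} {j} k∣j))

≡I-mod⇒∣tr-2 : ∀ {p} X → ≡I-mod p X → (+ p) ℤ.∣ (tr X ℤ.- + 2)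
≡I-mod⇒∣tr-2 {p} (mat a _ _ d) (p∣a-1 , _ , _ , p∣d-1) =
  subst ((+ p) ℤ.∣_) (split a d) (∣i∣j⇒∣i+j {+ p} {a ℤ.- + 1} {d ℤ.- + 1} p∣a-1 p∣d-1)
  where
  split : ∀ a d → (a ℤ.- + 1) ℤ.+ (d ℤ.- + 1) ≡ (a ℤ.+ d) ℤ.- + 2
  split = solve-∀

module HyperbolicTraces (A : Mat2) (det≡1 : det A ≡ + 1) (2<s : 2 < ∣ tr A ∣) where

  s : ℕ
  s = ∣ tr A ∣

  T : ℕ → ℤ
  T n = tr (A ^ᴹ n)

  ∣T∣ : ℕ → ℕ
  ∣T∣ n = ∣ T n ∣

  T-recurrence : ∀ n → T (2 + n) ≡ tr A ℤ.* T (suc n) ℤ.- T n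
  T-recurrence n = begin
    tr (A ⊗ (A ⊗ X))                              ≡⟨ tr-cayley-hamilton A X ⟩
    tr A ℤ.* tr (A ⊗ X) ℤ.- det A ℤ.* tr X        ≡⟨ cong (λ δ → tr A ℤ.* tr (A ⊗ X) ℤ.- δ ℤ.* tr X) det≡1 ⟩
    tr A ℤ.* tr (A ⊗ X) ℤ.- + 1 ℤ.* tr X          ≡⟨ cong (ℤ._-_ (tr A ℤ.* tr (A ⊗ X))) (ℤ.*-identityˡ (tr X)) ⟩
    tr A ℤ.* tr (A ⊗ X) ℤ.- tr X                  ∎
    where
    open ≡-Reasoning
    X : Mat2
    X = A ^ᴹ n

  open ≤-Reasoning

  ∣T₁∣≡s : ∣T∣ 1 ≡ s
  ∣T₁∣≡s = cong ∣_∣ (tr-⊗-I₂ A)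

  ∣T∣-convex : ∀ n → s * ∣T∣ (suc n) ≤ ∣T∣ (2 + n) + ∣T∣ n
  ∣T∣-convex n = begin
    s * ∣T∣ (suc n)                          ≡⟨ ℤ.abs-* (tr A) (T (suc n)) ⟨
    ∣ tr A ℤ.* T (suc n) ∣                   ≤⟨ ∣i∣≤∣i-j∣+∣j∣ (tr A ℤ.* T (suc n)) (T n) ⟩
    ∣ tr A ℤ.* T (suc n) ℤ.- T n ∣ + ∣T∣ n   ≡⟨ cong (λ i → ∣ i ∣ + ∣T∣ n) (T-recurrence n) ⟨
    ∣T∣ (2 + n) + ∣T∣ n                      ∎

  ∣T∣-recurrence : ∀ n → ∣T∣ (2 + n) ≤ s * ∣T∣ (suc n) + ∣T∣ n
  ∣T∣-recurrence n = begin
    ∣T∣ (2 + n)                         ≡⟨ cong ∣_∣ (T-recurrence n) ⟩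
    ∣ tr A ℤ.* T (suc n) ℤ.- T n ∣      ≤⟨ ℤ.∣i-j∣≤∣i∣+∣j∣ (tr A ℤ.* T (suc n)) (T n) ⟩
    ∣ tr A ℤ.* T (suc n) ∣ + ∣T∣ n      ≡⟨ cong (_+ ∣T∣ n) (ℤ.abs-* (tr A) (T (suc n))) ⟩
    s * ∣T∣ (suc n) + ∣T∣ n             ∎

  s≤∣T[1+n]∣ : ∀ n → s ≤ ∣T∣ (suc n)
  s≤∣T[1+n]∣ n = subst (_≤ ∣T∣ (suc n)) ∣T₁∣≡s
    (nondecreasing⇒monotone ∣T∣ (convex⇒nondecreasing ∣T∣ convex ∣T₀∣≤∣T₁∣) (s≤s (z≤n {n})))
    where
    convex : ∀ n → 2 * ∣T∣ (suc n) ≤ ∣T∣ (2 + n) + ∣T∣ n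
    convex n = ≤-trans (*-monoˡ-≤ (∣T∣ (suc n)) (<⇒≤ 2<s)) (∣T∣-convex n)
    ∣T₀∣≤∣T₁∣ : ∣T∣ 0 ≤ ∣T∣ 1
    ∣T₀∣≤∣T₁∣ = subst (2 ≤_) (sym ∣T₁∣≡s) (<⇒≤ 2<s)

  2≤1+s : 2 ≤ suc s
  2≤1+s = s≤s (≤-trans (s≤s z≤n) 2<s)

  ∣T∣≤[1+s]^[1+n] : ∀ n → ∣T∣ n ≤ suc s ^ suc n
  ∣T∣≤[1+s]^[1+n] = exponential-bound ∣T∣ s ∣T∣-recurrence 2≤1+s
    (subst (_≤ suc s ^ 2) (sym ∣T₁∣≡s) (≤-trans (n≤1+n s) (m≤m*n (suc s) (suc s ^ 1))))

  ∣T-2∣ : ℕ → ℕ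
  ∣T-2∣ n = ∣ T n ℤ.- + 2 ∣

  ∣T[1+n]-2∣>0 : ∀ n → 0 < ∣T-2∣ (suc n)
  ∣T[1+n]-2∣>0 n = +-cancelʳ-≤ 2 1 (∣T-2∣ (suc n)) (begin
    3                   ≤⟨ 2<s ⟩
    s                   ≤⟨ s≤∣T[1+n]∣ n ⟩
    ∣T∣ (suc n)         ≤⟨ ∣i∣≤∣i-j∣+∣j∣ (T (suc n)) (+ 2) ⟩
    ∣T-2∣ (suc n) + 2   ∎)

  ∣T-2∣≤[1+s]^[2+n] : ∀ n → ∣T-2∣ n ≤ suc s ^ (2 + n)
  ∣T-2∣≤[1+s]^[2+n] n = begin
    ∣T-2∣ n     ≤⟨ ℤ.∣i-j∣≤∣i∣+∣j∣ (T n) (+ 2) ⟩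
    ∣T∣ n + 2   ≤⟨ +-mono-≤ (∣T∣≤[1+s]^[1+n] n) 2≤r ⟩
    r + r       ≡⟨ cong (_+_ r) (+-identityʳ r) ⟨
    2 * r       ≤⟨ *-monoˡ-≤ r 2≤1+s ⟩
    suc s * r   ∎
    where
    r : ℕ
    r = suc s ^ suc n
    2≤r : 2 ≤ r
    2≤r = ≤-trans 2≤1+s (m≤m*n (suc s) (suc s ^ n) {{m^n≢0 (suc s) n}})

  B : ℕ
  B = suc s ^ 3

  ∣T[1+i]-2∣≤B^y : ∀ {i y} → i < y → ∣T-2∣ (suc i) ≤ B ^ y
  ∣T[1+i]-2∣≤B^y {i} {y} i<y = begin
    ∣T-2∣ (suc i)     ≤⟨ ∣T-2∣≤[1+s]^[2+n] (suc i) ⟩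
    suc s ^ (3 + i)   ≤⟨ ^-monoʳ-≤ (suc s) 3+i≤3*y ⟩
    suc s ^ (3 * y)   ≡⟨ ^-*-assoc (suc s) 3 y ⟨
    B ^ y             ∎
    where
    1≤y : 1 ≤ y
    1≤y = ≤-trans (s≤s z≤n) i<y
    3+i≤3*y : 3 + i ≤ 3 * y
    3+i≤3*y = +-mono-≤ 1≤y (+-mono-≤ 1≤y (≤-trans i<y (m≤m+n y 0)))

  ∣T-2∣-upTo : ℕ → List ℕ
  ∣T-2∣-upTo y = applyUpTo (∣T-2∣ ∘ suc) y

  product-∣T-2∣-upTo≢0 : ∀ y → NonZero (product (∣T-2∣-upTo y))
  product-∣T-2∣-upTo≢0 y = product≢0 (applyUpTo⁺₂ (∣T-2∣ ∘ suc) y (λ i → >-nonZero (∣T[1+n]-2∣>0 i)))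

  product-∣T-2∣-upTo≤B^[y*y] : ∀ y → product (∣T-2∣-upTo y) ≤ B ^ (y * y)
  product-∣T-2∣-upTo≤B^[y*y] y = begin
    product (∣T-2∣-upTo y)            ≤⟨ product≤^length (applyUpTo⁺₁ (∣T-2∣ ∘ suc) y ∣T[1+i]-2∣≤B^y) ⟩
    (B ^ y) ^ length (∣T-2∣-upTo y)   ≡⟨ cong ((B ^ y) ^_) (length-applyUpTo (∣T-2∣ ∘ suc) y) ⟩
    (B ^ y) ^ y                       ≡⟨ ^-*-assoc B y y ⟩
    B ^ (y * y)                       ∎

  ord≤⇒∣product-∣T-2∣-upTo : ∀ {p y} → OrdLe p A y → p ∣ product (∣T-2∣-upTo y)
  ord≤⇒∣product-∣T-2∣-upTo (zero  , ((() , _) , _))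
  ord≤⇒∣product-∣T-2∣-upTo (suc i , ((_ , Aⁿ≡I , _) , i<y)) =
    ∣-trans (≡I-mod⇒∣tr-2 (A ^ᴹ suc i) Aⁿ≡I) (∈⇒∣product (∈-applyUpTo⁺ (∣T-2∣ ∘ suc) i<y))

lemma6 : (A : Mat2) → det A ≡ + 1 → 2 < ∣ tr A ∣ →
    Σ ℕ (λ C → (y : ℕ) → 1 ≤ y → (ps : List ℕ) → Unique ps →
    All (λ p → Prime p × OrdLe p A y) ps → length ps ≤ C * (y * y))
lemma6 A det≡1 2<∣trA∣ = B , λ y _ ps unique ps-ok → ^-cancelˡ-≤ 2 (s≤s (s≤s z≤n)) (begin
  2 ^ length ps            ≤⟨ distinct-primes∣⇒2^length≤ {{product-∣T-2∣-upTo≢0 y}} unique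
                                (All.map (map₂ ord≤⇒∣product-∣T-2∣-upTo) ps-ok) ⟩
  product (∣T-2∣-upTo y)   ≤⟨ product-∣T-2∣-upTo≤B^[y*y] y ⟩
  B ^ (y * y)              ≤⟨ ^-monoˡ-≤ (y * y) (<⇒≤ (n<2^n B)) ⟩
  (2 ^ B) ^ (y * y)        ≡⟨ ^-*-assoc 2 B (y * y) ⟩
  2 ^ (B * (y * y))        ∎)
  where
  open HyperbolicTraces A det≡1 2<∣trA∣
  open ≤-Reasoning
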